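{- Let $G$ be a finite simple graph with totally ordered vertex set $I$. Every Lyndon heap over $G$ is an admissible pyramid.
   Context: Heaps: two vertices commute if distinct and non-adjacent; heaps are elements of the quotient of the free monoid on $I$ by the congruence generated by $ab=ba$ for commuting $a,b$, with product $\circ$ induced by concatenation. For a word $p_1\cdots p_r$ its pieces are partially ordered by the transitive closure of $p_s<p_t$ when $s<t$ and $p_s,p_t$ are equal or adjacent; this poset depends only on the heap. A pyramid is a heap with a unique minimal piece (its basis); it is admissible if the position of its basis is the least (in the order on $I$) among the positions of its pieces. Order words lexicographically (proper prefix smaller); $\operatorname{st}(E)$ is the largest word representing $E$ and $E\le F$ iff $\operatorname{st}(E)\le\operatorname{st}(F)$. $E$ is primitive if $E=U\circ V=V\circ U$ forces $U$ or $V$ empty; conjugacy is the transitive closure of $U\circ V\mapsto V\circ U$; a Lyndon heap is nonempty, primitive and minimal in its conjugacy class. -}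

module Defs where

open import Data.Nat using (ℕ)
open import Data.Fin using (Fin; toℕ) renaming (_<_ to _<ᶠ_; _≤_ to _≤ᶠ_)
open import Data.Bool using (Bool; true; false)
open import Data.List using (List; []; _∷_; _++_; length; lookup)
open import Data.Product using (Σ; _×_; _,_; ∃)
open import Data.Sum using (_⊎_)
open import Relation.Binary.PropositionalEquality using (_≡_; _≢_)
open import Relation.Nullary using (¬_)

-- A finite simple graph on the totally ordered vertex set I = Fin n
-- (ordered by the standard order of Fin n).
record SimpleGraph (n : ℕ) : Set where
  field
    adj    : Fin n → Fin n → Bool
    sym    : ∀ i j → adj i j ≡ adj j i
    irrefl : ∀ i → adj i i ≡ false

module Heaps {n : ℕ} (G : SimpleGraph n) where
  open SimpleGraph G

  Vertex : Set
  Vertex = Fin n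

  Word : Set
  Word = List Vertex

  Commute : Vertex → Vertex → Set
  Commute a b = a ≢ b × adj a b ≡ false

  Linked : Vertex → Vertex → Set
  Linked a b = a ≡ b ⊎ adj a b ≡ true

  -- The monoid congruence on words generated by ab = ba for commuting a, b
  -- (heaps = equivalence classes of words for _≈_; product = concatenation).
  data _≈_ : Word → Word → Set where
    ≈-refl  : ∀ {w} → w ≈ w
    ≈-sym   : ∀ {w w'} → w ≈ w' → w' ≈ w
    ≈-trans : ∀ {w₁ w₂ w₃} → w₁ ≈ w₂ → w₂ ≈ w₃ → w₁ ≈ w₃
    ≈-swap  : ∀ u v a b → Commute a b → (u ++ a ∷ b ∷ v) ≈ (u ++ b ∷ a ∷ v)

  Piece : Word → Set
  Piece w = Fin (length w)

  label : (w : Word) → Piece w → Vertex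
  label w = lookup w

  data PieceLt (w : Word) : Piece w → Piece w → Set where
    gen   : ∀ {s t} → toℕ s Data.Nat.< toℕ t → Linked (label w s) (label w t) → PieceLt w s t
    trans : ∀ {s t u} → PieceLt w s t → PieceLt w t u → PieceLt w s u

  Minimal : (w : Word) → Piece w → Set
  Minimal w t = ¬ (Σ (Piece w) λ s → PieceLt w s t)

  IsBasis : (w : Word) → Piece w → Set
  IsBasis w b = Minimal w b × (∀ t → Minimal w t → t ≡ b)

  Pyramid : Word → Set
  Pyramid w = Σ (Piece w) (IsBasis w)

  AdmissiblePyramid : Word → Set
  AdmissiblePyramid w =
    Σ (Piece w) λ b → IsBasis w b × (∀ k → label w b ≤ᶠ label w k)

  data _≤lex_ : Word → Word → Set where
    []≤   : ∀ {ys} → [] ≤lex ys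
    head< : ∀ {x y xs ys} → x <ᶠ y → (x ∷ xs) ≤lex (y ∷ ys)
    head≡ : ∀ {x xs ys} → xs ≤lex ys → (x ∷ xs) ≤lex (x ∷ ys)

  -- s is st(E) for the heap E represented by w: the largest representing word
  IsSt : Word → Word → Set
  IsSt w s = s ≈ w × (∀ s' → s' ≈ w → s' ≤lex s)

  HeapLeq : Word → Word → Set
  HeapLeq e f = ∀ s t → IsSt e s → IsSt f t → s ≤lex t

  Primitive : Word → Set
  Primitive w = ∀ u v → w ≈ (u ++ v) → w ≈ (v ++ u) → u ≡ [] ⊎ v ≡ []

  data Conj : Word → Word → Set where
    step  : ∀ {w w'} u v → w ≈ (u ++ v) → w' ≈ (v ++ u) → Conj w w'
    trans : ∀ {w₁ w₂ w₃} → Conj w₁ w₂ → Conj w₂ w₃ → Conj w₁ w₃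

  Lyndon : Word → Set
  Lyndon w = (w ≢ []) × Primitive w × (∀ w' → Conj w w' → HeapLeq w w')

module Submission where

-- A letter c is a front letter of w when c
-- commutes with every letter before its first occurrence, so that w ≈ c ∷ w′;
-- front letters are exactly the labels of minimal pieces.  Let w be a Lyndon
-- word and m its least letter.  As w is primitive, some conjugate y of w has m as its only
--      front letter.  y is found by sifting: letters equal to m or linked to
--      the rooted prefix built so far join it, the other letters are moved in
--      front and then rotated to the back.  If at some stage no letter joins,
--      the leftover letters commute with the rooted prefix, and splitting w by
--      letter content writes w = U∘V = V∘U with U, V nonempty.
--  (2) Standard words.  The first letter of st(w) is the largest front letter
--      of w, so st(w) ≤ st(y) bounds every front letter of w by a front letter
--      of y, i.e. by m.  As m is least, m is the only front letter of w.
--  (3) A word whose only front letter is m is a pyramid with basis its first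
--      piece, labelled m; it is admissible because m is the least letter.

open import Defs
open import Data.Nat using (ℕ; zero; suc; z≤n; s≤s) renaming (_≤_ to _≤ℕ_; _<_ to _<ℕ_)
import Data.Nat.Properties as ℕ
open import Data.Fin using (toℕ; _≟_) renaming (zero to fzero; suc to fsuc; _≤_ to _≤ᶠ_)
import Data.Fin.Properties as Fin
open import Data.Bool using (true; false)
open import Data.List using ([]; _∷_; [_]; _++_; length; lookup; filter)
open import Data.List.Properties using (++-assoc; ++-identityʳ)
open import Data.List.Relation.Unary.Any using (Any; here; there)
open import Data.List.Relation.Unary.Any.Properties using (¬Any[]; ++⁻; ++⁺ˡ; ++⁺ʳ; ++-comm)
open import Data.List.Relation.Unary.All as All using (All; []; _∷_)
open import Data.List.Membership.Propositional using (_∈_; _∉_)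
open import Data.List.Membership.Propositional.Properties using (∈-lookup; ∈-filter⁺; ∈-filter⁻)
open import Data.Product using (Σ; _×_; _,_; proj₁; proj₂)
open import Data.Sum using (_⊎_; inj₁; inj₂)
import Data.Sum as Sum
import Data.Product as Product
open import Data.Empty using (⊥; ⊥-elim)
open import Relation.Binary.PropositionalEquality
  using (_≡_; _≢_; refl; sym; cong; subst; subst₂) renaming (trans to ≡-trans)
open import Relation.Nullary using (¬_; Dec; yes; no)
open import Relation.Unary using (Decidable)
open import Relation.Unary.Properties using (∁?)

module Proof {n : ℕ} (G : SimpleGraph n) where
  open SimpleGraph G using (adj)
  open Heaps G
  open import Data.List.Extrema (Fin.≤-totalOrder n)
    using (min; max; min≤⊤; min≤xs; xs≤max; argmin-sel; argmax-sel)
  open import Data.List.Membership.DecPropositional (_≟_ {n}) using (_∈?_)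

  commute-sym : ∀ {a b} → Commute a b → Commute b a
  commute-sym {a} {b} (a≢b , ab) = (λ b≡a → a≢b (sym b≡a)) , ≡-trans (SimpleGraph.sym G b a) ab

  linked⇒¬commute : ∀ {a b} → Linked a b → ¬ Commute a b
  linked⇒¬commute (inj₁ a≡b) (a≢b , _) = a≢b a≡b
  linked⇒¬commute (inj₂ ab) (_ , ab′) with ≡-trans (sym ab) ab′
  ... | ()

  linked-or-commute : ∀ a b → Linked a b ⊎ Commute a b
  linked-or-commute a b with a ≟ b | adj a b
  ... | yes a≡b | _     = inj₁ (inj₁ a≡b)
  ... | no _    | true  = inj₁ (inj₂ refl)
  ... | no a≢b  | false = inj₂ (a≢b , refl)

  ∷-cong : ∀ {x w w′} → w ≈ w′ → (x ∷ w) ≈ (x ∷ w′)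
  ∷-cong ≈-refl              = ≈-refl
  ∷-cong (≈-sym e)           = ≈-sym (∷-cong e)
  ∷-cong (≈-trans e e′)      = ≈-trans (∷-cong e) (∷-cong e′)
  ∷-cong {x} (≈-swap u v a b c) = ≈-swap (x ∷ u) v a b c

  swap-head : ∀ {a b v} → Commute a b → (a ∷ b ∷ v) ≈ (b ∷ a ∷ v)
  swap-head {a} {b} {v} c = ≈-swap [] v a b c

  pass-block : ∀ {c y} U → All (Commute c) U → (U ++ c ∷ y) ≈ (c ∷ U ++ y)
  pass-block []      []         = ≈-refl
  pass-block (x ∷ U) (cx ∷ cU) = ≈-trans (∷-cong (pass-block U cU)) (swap-head (commute-sym cx))

  conj-refl : ∀ {w} → Conj w w
  conj-refl {w} = step [] w ≈-refl (subst (w ≈_) (sym (++-identityʳ w)) ≈-refl)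

  -- A property of words that survives every elementary swap is invariant under
  -- _≈_ (both directions are carried along to handle ≈-sym).
  SwapStable : (Word → Set) → Set
  SwapStable P = ∀ u v a b → Commute a b → P (u ++ a ∷ b ∷ v) → P (u ++ b ∷ a ∷ v)

  ≈-invariant : ∀ P → SwapStable P → ∀ {w w′} → w ≈ w′ → (P w → P w′) × (P w′ → P w)
  ≈-invariant P stable ≈-refl = (λ p → p) , (λ p → p)
  ≈-invariant P stable (≈-sym e) = proj₂ (≈-invariant P stable e) , proj₁ (≈-invariant P stable e)
  ≈-invariant P stable (≈-trans e e′) =
    (λ p → proj₁ (≈-invariant P stable e′) (proj₁ (≈-invariant P stable e) p)) ,
    (λ p → proj₂ (≈-invariant P stable e) (proj₂ (≈-invariant P stable e′) p))
  ≈-invariant P stable (≈-swap u v a b c) = stable u v a b c , stable u v b a (commute-sym c)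

  ≈-transport : ∀ P → SwapStable P → ∀ {w w′} → w ≈ w′ → P w → P w′
  ≈-transport P stable e = proj₁ (≈-invariant P stable e)

  ∈-swap-stable : ∀ x → SwapStable (x ∈_)
  ∈-swap-stable x []      v a b c (here p)         = there (here p)
  ∈-swap-stable x []      v a b c (there (here p)) = here p
  ∈-swap-stable x []      v a b c (there (there p)) = there (there p)
  ∈-swap-stable x (y ∷ u) v a b c (here p)         = here p
  ∈-swap-stable x (y ∷ u) v a b c (there p)        = there (∈-swap-stable x u v a b c p)

  ∈-≈ : ∀ {x w w′} → w ≈ w′ → x ∈ w → x ∈ w′
  ∈-≈ {x} = ≈-transport (x ∈_) (∈-swap-stable x)

  ∈-conj : ∀ {x w w′} → Conj w w′ → (x ∈ w → x ∈ w′) × (x ∈ w′ → x ∈ w)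
  ∈-conj (step u v e e′) =
    (λ p → ∈-≈ (≈-sym e′) (++-comm u v (∈-≈ e p))) ,
    (λ p → ∈-≈ (≈-sym e) (++-comm v u (∈-≈ e′ p)))
  ∈-conj (trans c c′) =
    (λ p → proj₁ (∈-conj c′) (proj₁ (∈-conj c) p)) ,
    (λ p → proj₂ (∈-conj c) (proj₂ (∈-conj c′) p))

  data Front (c : Vertex) : Word → Set where
    here  : ∀ {w} → Front c (c ∷ w)
    there : ∀ {x w} → Commute c x → Front c w → Front c (x ∷ w)

  SoleFront : Vertex → Word → Set
  SoleFront m y = ∀ {c} → Front c y → c ≡ m

  front-swap-stable : ∀ c → SwapStable (Front c)
  front-swap-stable c []      v a b ab here                     = there ab here
  front-swap-stable c []      v a b ab (there _ here)           = here
  front-swap-stable c []      v a b ab (there ca (there cb f)) = there cb (there ca f)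
  front-swap-stable c (x ∷ u) v a b ab here                     = here
  front-swap-stable c (x ∷ u) v a b ab (there cx f)             = there cx (front-swap-stable c u v a b ab f)

  front-≈ : ∀ {c w w′} → w ≈ w′ → Front c w → Front c w′
  front-≈ {c} = ≈-transport (Front c) (front-swap-stable c)

  front-∈ : ∀ {c w} → Front c w → c ∈ w
  front-∈ here        = here refl
  front-∈ (there _ f) = there (front-∈ f)

  front? : ∀ c w → Dec (Front c w)
  front? c [] = no λ ()
  front? c (x ∷ w) with x ≟ c
  ... | yes refl = yes here
  ... | no x≢c with linked-or-commute c x | front? c w
  ...   | inj₁ l  | _     = no λ { here → x≢c refl ; (there cx _) → linked⇒¬commute l cx }
  ...   | inj₂ cx | yes f = yes (there cx f)
  ...   | inj₂ _  | no ¬f = no λ { here → x≢c refl ; (there _ f) → ¬f f }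

  del : Vertex → Word → Word
  del c [] = []
  del c (x ∷ w) with x ≟ c
  ... | yes _ = w
  ... | no _  = x ∷ del c w

  del-head : ∀ {c x} w → x ≡ c → del c (x ∷ w) ≡ w
  del-head {c} {x} w x≡c with x ≟ c
  ... | yes _  = refl
  ... | no x≢c = ⊥-elim (x≢c x≡c)

  del-skip : ∀ {c x} w → x ≢ c → del c (x ∷ w) ≡ x ∷ del c w
  del-skip {c} {x} w x≢c with x ≟ c
  ... | yes x≡c = ⊥-elim (x≢c x≡c)
  ... | no _    = refl

  front-del : ∀ {c w} → Front c w → w ≈ (c ∷ del c w)
  front-del {c} (here {w}) rewrite del-head {c} w refl = ≈-refl
  front-del {c} (there {x} {w} cx f) rewrite del-skip {c} {x} w (λ x≡c → proj₁ cx (sym x≡c)) =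
    ≈-trans (∷-cong (front-del f)) (swap-head (commute-sym cx))

  front-del-length : ∀ {c w} → Front c w → suc (length (del c w)) ≡ length w
  front-del-length {c} (here {w}) rewrite del-head {c} w refl = refl
  front-del-length {c} (there {x} {w} cx f) rewrite del-skip {c} {x} w (λ x≡c → proj₁ cx (sym x≡c)) =
    cong suc (front-del-length f)

  del-swap : ∀ c u v a b → Commute a b → del c (u ++ a ∷ b ∷ v) ≈ del c (u ++ b ∷ a ∷ v)
  del-swap c [] v a b ab with a ≟ c | b ≟ c
  ... | yes a≡c | yes b≡c = ⊥-elim (proj₁ ab (≡-trans a≡c (sym b≡c)))
  ... | yes a≡c | no b≢c  rewrite del-head {c} v a≡c = ≈-refl
  ... | no a≢c  | yes b≡c rewrite del-head {c} v b≡c = ≈-refl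
  ... | no a≢c  | no b≢c  rewrite del-skip {c} v a≢c | del-skip {c} v b≢c = swap-head ab
  del-swap c (x ∷ u) v a b ab with x ≟ c
  ... | yes _ = ≈-swap u v a b ab
  ... | no _  = ∷-cong (del-swap c u v a b ab)

  del-≈ : ∀ {c w w′} → w ≈ w′ → del c w ≈ del c w′
  del-≈ ≈-refl             = ≈-refl
  del-≈ (≈-sym e)          = ≈-sym (del-≈ e)
  del-≈ (≈-trans e e′)     = ≈-trans (del-≈ e) (del-≈ e′)
  del-≈ {c} (≈-swap u v a b ab) = del-swap c u v a b ab

  largest-front : ∀ {x w} → Front x w → Σ Vertex λ a → Front a w × (∀ {c} → Front c w → c ≤ᶠ a)
  largest-front {x} {w} fx = max x fronts , selected (argmax-sel (λ c → c) x fronts) , bound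
    where
    fronts : Word
    fronts = filter (λ c → front? c w) w
    selected : max x fronts ≡ x ⊎ max x fronts ∈ fronts → Front (max x fronts) w
    selected (inj₁ max≡x) = subst (λ a → Front a w) (sym max≡x) fx
    selected (inj₂ max∈)  = proj₂ (∈-filter⁻ (λ c → front? c w) {xs = w} max∈)
    bound : ∀ {c} → Front c w → c ≤ᶠ max x fronts
    bound fc = All.lookup (xs≤max x fronts) (∈-filter⁺ (λ c → front? c w) (front-∈ fc) fc)

  lex-head : ∀ {a b s t} → (a ∷ s) ≤lex (b ∷ t) → a ≤ᶠ b
  lex-head (head< a<b) = ℕ.<⇒≤ a<b
  lex-head (head≡ _)   = Fin.≤-refl

  -- st(w) exists: it starts with the largest front letter a of w and continues
  -- with st(del a w).  The recursion is on the length of w.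
  standard-word-of-length : ∀ k w → length w ≡ k → Σ Word (IsSt w)
  standard-word-of-length _ [] _ = [] , ≈-refl , maximal
    where
    maximal : ∀ s → s ≈ [] → s ≤lex []
    maximal []      _ = []≤
    maximal (d ∷ s) e with front-≈ e here
    ... | ()
  standard-word-of-length zero    (x ∷ w) ()
  standard-word-of-length (suc k) (x ∷ w) |w|≡k with largest-front {x} {x ∷ w} here
  ... | a , fa , a-largest
      with standard-word-of-length k (del a (x ∷ w)) (ℕ.suc-injective (≡-trans (front-del-length fa) |w|≡k))
  ...   | s , s≈ , s-maximal = a ∷ s , ≈-trans (∷-cong s≈) (≈-sym (front-del fa)) , maximal
    where
    maximal : ∀ s′ → s′ ≈ (x ∷ w) → s′ ≤lex (a ∷ s)
    maximal []       _ = []≤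
    maximal (d ∷ s′) e with d ≟ a
    ... | yes refl = head≡ (s-maximal s′ (subst (_≈ del a (x ∷ w)) (del-head s′ refl) (del-≈ e)))
    ... | no d≢a   = head< (Fin.≤∧≢⇒< (a-largest (front-≈ e here)) d≢a)

  standard-word : ∀ w → Σ Word (IsSt w)
  standard-word w = standard-word-of-length (length w) w refl

  st-head-front : ∀ {w a s} → IsSt w (a ∷ s) → Front a w
  st-head-front (s≈w , _) = front-≈ s≈w here

  front≤st-head : ∀ {w a s e} → IsSt w (a ∷ s) → Front e w → e ≤ᶠ a
  front≤st-head {w} {e = e} (_ , maximal) fe = lex-head (maximal (e ∷ del e w) (≈-sym (front-del fe)))

  front-bounded : ∀ {w y e} → HeapLeq w y → Front e w → Σ Vertex λ c → Front c y × e ≤ᶠ c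
  front-bounded {w} {y} w≤y fe with standard-word w | standard-word y
  ... | [] , []≈w , _ | _ with front-≈ (≈-sym []≈w) fe
  ...   | ()
  front-bounded w≤y fe | a ∷ s , st-w | [] , st-y with w≤y (a ∷ s) [] st-w st-y
  ...   | ()
  front-bounded w≤y fe | a ∷ s , st-w | c ∷ t , st-y =
    c , st-head-front st-y , Fin.≤-trans (front≤st-head st-w fe) (lex-head (w≤y _ _ st-w st-y))

  sole-front-transfer : ∀ {m w y} → (∀ {c} → c ∈ w → m ≤ᶠ c) → HeapLeq w y →
                        SoleFront m y → SoleFront m w
  sole-front-transfer {m} m-least w≤y y-sole {e} fe with front-bounded w≤y fe
  ... | c , fc , e≤c = Fin.≤-antisym (subst (e ≤ᶠ_) (y-sole fc) e≤c) (m-least (front-∈ fe))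

  partition-commuting : ∀ {P : Vertex → Set} (P? : Decidable P) xs →
    (∀ {a b} → a ∈ xs → b ∈ xs → P a → ¬ P b → Commute a b) →
    xs ≈ (filter P? xs ++ filter (∁? P?) xs) × xs ≈ (filter (∁? P?) xs ++ filter P? xs)
  partition-commuting P? [] _ = ≈-refl , ≈-refl
  partition-commuting {P} P? (x ∷ xs) sep
    with P? x | partition-commuting P? xs (λ a b → sep (there a) (there b))
  ... | yes px | e₁ , e₂ =
    ∷-cong e₁ , ≈-trans (∷-cong e₂) (≈-sym (pass-block (filter (∁? P?) xs) (x-commutes-with-rest px)))
    where
    x-commutes-with-rest : P x → All (Commute x) (filter (∁? P?) xs)
    x-commutes-with-rest px = All.tabulate λ b∈ →
      let b∈xs , ¬pb = ∈-filter⁻ (∁? P?) {xs = xs} b∈ in sep (here refl) (there b∈xs) px ¬pb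
  ... | no ¬px | e₁ , e₂ =
    ≈-trans (∷-cong e₁) (≈-sym (pass-block (filter P? xs) (x-commutes-with-part ¬px))) , ∷-cong e₂
    where
    x-commutes-with-part : ¬ P x → All (Commute x) (filter P? xs)
    x-commutes-with-part ¬px = All.tabulate λ a∈ →
      let a∈xs , pa = ∈-filter⁻ P? {xs = xs} a∈ in commute-sym (sep (there a∈xs) (here refl) pa ¬px)

  -- A primitive word is not conjugate to a product U ++ V of nonempty words
  -- whose letters commute pairwise: w itself would split as A∘B = B∘A, with A
  -- its letters in U and B the others.
  commuting-factors : ∀ {w U V a b} → Primitive w → Conj w (U ++ V) →
    (∀ {c d} → c ∈ U → d ∈ V → Commute c d) → a ∈ U → b ∈ V → ⊥
  commuting-factors {w} {U} {V} {a} {b} prim cj sep a∈U b∈V =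
    one-part-empty (prim (filter inU? w) (filter (∁? inU?) w) (proj₁ split) (proj₂ split))
    where
    inU? : Decidable (_∈ U)
    inU? c = c ∈? U
    separated : ∀ {c d} → c ∈ w → d ∈ w → c ∈ U → d ∉ U → Commute c d
    separated _ d∈w c∈U d∉U with ++⁻ U (proj₁ (∈-conj cj) d∈w)
    ... | inj₁ d∈U = ⊥-elim (d∉U d∈U)
    ... | inj₂ d∈V = sep c∈U d∈V
    split : w ≈ (filter inU? w ++ filter (∁? inU?) w) × w ≈ (filter (∁? inU?) w ++ filter inU? w)
    split = partition-commuting inU? w separated
    b∉U : b ∉ U
    b∉U b∈U = proj₁ (sep b∈U b∈V) refl
    one-part-empty : filter inU? w ≡ [] ⊎ filter (∁? inU?) w ≡ [] → ⊥
    one-part-empty (inj₁ A≡[]) =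
      ¬Any[] (subst (a ∈_) A≡[] (∈-filter⁺ inU? (proj₂ (∈-conj cj) (++⁺ˡ a∈U)) a∈U))
    one-part-empty (inj₂ B≡[]) =
      ¬Any[] (subst (b ∈_) B≡[] (∈-filter⁺ (∁? inU?) (proj₂ (∈-conj cj) (++⁺ʳ U b∈V)) b∉U))

  linked-or-commutes-with-all : ∀ c U → Any (Linked c) U ⊎ All (Commute c) U
  linked-or-commutes-with-all c [] = inj₂ []
  linked-or-commutes-with-all c (x ∷ U) with linked-or-commute c x | linked-or-commutes-with-all c U
  ... | inj₁ l  | _       = inj₁ (here l)
  ... | inj₂ _  | inj₁ ls = inj₁ (there ls)
  ... | inj₂ cx | inj₂ cU = inj₂ (cx ∷ cU)

  linked-and-commutes-with-all : ∀ {c U} → Any (Linked c) U → ¬ All (Commute c) U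
  linked-and-commutes-with-all ls cU with All.lookupAny cU ls
  ... | commutes , linked = linked⇒¬commute linked commutes

  front-++ : ∀ {c} U {V} → Front c (U ++ V) → Front c U ⊎ (All (Commute c) U × Front c V)
  front-++ []      f = inj₂ ([] , f)
  front-++ (x ∷ U) here = inj₁ here
  front-++ (x ∷ U) (there cx f) = Sum.map (there cx) (Product.map₁ (cx ∷_)) (front-++ U f)

  module Rooting (m : Vertex) where
    Attached : Word → Vertex → Set
    Attached U c = c ≡ m ⊎ Any (Linked c) U

    Detached : Word → Vertex → Set
    Detached U c = c ≢ m × All (Commute c) U

    attached-or-detached : ∀ U c → Attached U c ⊎ Detached U c
    attached-or-detached U c with c ≟ m | linked-or-commutes-with-all c U
    ... | yes c≡m | _       = inj₁ (inj₁ c≡m)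
    ... | no _    | inj₁ ls = inj₁ (inj₂ ls)
    ... | no c≢m  | inj₂ cU = inj₂ (c≢m , cU)

    data Rooted : Word → Set where
      root-[]   : Rooted []
      root-snoc : ∀ {U c} → Rooted U → Attached U c → Rooted (U ++ [ c ])

    rooted-front : ∀ {U} → Rooted U → SoleFront m U
    rooted-front root-[] ()
    rooted-front (root-snoc {U} r att) f with front-++ U f
    ... | inj₁ fU               = rooted-front r fU
    ... | inj₂ (_  , there _ ())
    ... | inj₂ (cU , here) with att
    ...   | inj₁ c≡m = c≡m
    ...   | inj₂ ls  = ⊥-elim (linked-and-commutes-with-all ls cU)

    sift : ∀ U y → Rooted U → Σ Word λ D → Σ Word λ U′ →
      (U ++ y) ≈ (D ++ U ++ U′) × Rooted (U ++ U′) × length D ≤ℕ length y ×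
      (All (Detached U) y ⊎ length D <ℕ length y)
    sift U [] r = [] , [] , ≈-refl , subst Rooted (sym (++-identityʳ U)) r , z≤n , inj₁ []
    sift U (c ∷ y) r with attached-or-detached U c
    ... | inj₁ att with sift (U ++ [ c ]) y (root-snoc r att)
    ...   | D , U′ , e , r′ , D≤y , _ =
      D , c ∷ U′ ,
      subst₂ (λ p q → p ≈ (D ++ q)) (++-assoc U [ c ] y) (++-assoc U [ c ] U′) e ,
      subst Rooted (++-assoc U [ c ] U′) r′ , ℕ.m≤n⇒m≤1+n D≤y , inj₂ (s≤s D≤y)
    sift U (c ∷ y) r | inj₂ det with sift U y r
    ...   | D , U′ , e , r′ , D≤y , progress =
      c ∷ D , U′ , ≈-trans (pass-block U (proj₂ det)) (∷-cong e) , r′ , s≤s D≤y ,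
      Sum.map (det ∷_) s≤s progress

    -- Repeated sifting and rotation of w ∼ U ++ D.  A round in which no letter
    -- joins is impossible for primitive w, since D would commute with U ∋ m.
    rotate : ∀ {w} → Primitive w → m ∈ w → ∀ k U D → length D ≤ℕ k → Rooted U →
             Conj w (U ++ D) → Σ Word λ y → Conj w y × SoleFront m y
    rotate prim m∈w k U [] _ r cj = U , subst (Conj _) (++-identityʳ U) cj , rooted-front r
    rotate prim m∈w zero U (d ∷ D) () r cj
    rotate prim m∈w (suc k) U (d ∷ D) (s≤s D≤k) r cj with sift U (d ∷ D) r
    ... | D′ , U′ , e , r′ , _ , inj₂ shorter =
      rotate prim m∈w k (U ++ U′) D′ (ℕ.≤-trans (ℕ.≤-pred shorter) D≤k) r′
        (trans cj (step D′ (U ++ U′) e ≈-refl))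
    ... | _ , _ , _ , _ , _ , inj₁ detached = ⊥-elim (commuting-factors prim cj separated m∈U (here refl))
      where
      separated : ∀ {c e} → c ∈ U → e ∈ d ∷ D → Commute c e
      separated c∈U e∈ = commute-sym (All.lookup (proj₂ (All.lookup detached e∈)) c∈U)
      m∈U : m ∈ U
      m∈U with ++⁻ U (proj₁ (∈-conj cj) m∈w)
      ... | inj₁ m∈U = m∈U
      ... | inj₂ m∈D = ⊥-elim (proj₁ (All.lookup detached m∈D) refl)

    sole-front-conjugate : ∀ {w} → Primitive w → m ∈ w → Σ Word λ y → Conj w y × SoleFront m y
    sole-front-conjugate {w} prim m∈w = rotate prim m∈w (length w) [] w ℕ.≤-refl root-[] conj-refl

  open Rooting using (sole-front-conjugate)

  piece-order⇒position : ∀ {w s t} → PieceLt w s t → toℕ s <ℕ toℕ t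
  piece-order⇒position (gen s<t _) = s<t
  piece-order⇒position (trans p q) = ℕ.<-trans (piece-order⇒position p) (piece-order⇒position q)

  front-or-covered : ∀ w (t : Piece w) → Front (label w t) w ⊎
    Σ (Piece w) λ s → toℕ s <ℕ toℕ t × Linked (label w s) (label w t)
  front-or-covered (y ∷ w) fzero = inj₁ here
  front-or-covered (y ∷ w) (fsuc t) with linked-or-commute y (lookup w t)
  ... | inj₁ l  = inj₂ (fzero , s≤s z≤n , l)
  ... | inj₂ yt with front-or-covered w t
  ...   | inj₁ f            = inj₁ (there (commute-sym yt) f)
  ...   | inj₂ (s , s<t , l) = inj₂ (fsuc s , s≤s s<t , l)

  -- A nonempty word whose only front letter is m is a pyramid with basis its
  -- first piece: every later piece is above that one or above another piece.
  head-basis : ∀ {m x w} → SoleFront m (x ∷ w) → IsBasis (x ∷ w) fzero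
  head-basis {m} {x} {w} sole = bottom , unique
    where
    bottom : Minimal (x ∷ w) fzero
    bottom (_ , s<0) with piece-order⇒position s<0
    ... | ()
    unique : ∀ t → Minimal (x ∷ w) t → t ≡ fzero
    unique fzero    _ = refl
    unique (fsuc t) t-minimal with front-or-covered (x ∷ w) (fsuc t)
    ... | inj₂ (s , s<t , l) = ⊥-elim (t-minimal (s , gen s<t l))
    ... | inj₁ f = ⊥-elim (t-minimal (fzero , gen (s≤s z≤n) (inj₁ (≡-trans (sole here) (sym (sole f))))))

  lyndon-admissible : ∀ {w} → Lyndon w → AdmissiblePyramid w
  lyndon-admissible {[]} (w≢[] , _) = ⊥-elim (w≢[] refl)
  lyndon-admissible {x ∷ w} (_ , prim , least) = fzero , head-basis w-sole , basis-least
    where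
    m : Vertex
    m = min x w
    m-least : ∀ {c} → c ∈ x ∷ w → m ≤ᶠ c
    m-least = All.lookup (min≤⊤ x w ∷ min≤xs x w)
    m∈w : m ∈ x ∷ w
    m∈w with argmin-sel (λ c → c) x w
    ... | inj₁ m≡x = here m≡x
    ... | inj₂ m∈w = there m∈w
    w-sole : SoleFront m (x ∷ w)
    w-sole with sole-front-conjugate m prim m∈w
    ... | y , w∼y , y-sole = sole-front-transfer m-least (least y w∼y) y-sole
    basis-least : ∀ k → x ≤ᶠ lookup (x ∷ w) k
    basis-least k = subst (_≤ᶠ lookup (x ∷ w) k) (sym (w-sole here)) (m-least (∈-lookup k))

lemma2p2 : (n : ℕ) (G : SimpleGraph n) (w : Heaps.Word G) →
    Heaps.Lyndon G w → Heaps.AdmissiblePyramid G w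
lemma2p2 n G w = Proof.lyndon-admissible G
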